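{- The unique numerical semigroup which is pseudo-symmetric and generated by an interval is $\{0,3,4,5,6,\dots\}=\{0\}\cup\{i\in\mathbb{N}_0:i\geq 3\}$.
   Context: A numerical semigroup is a subset $\Lambda\subseteq\mathbb{N}_0$ containing $0$, closed under addition, with finite complement in $\mathbb{N}_0$. Its genus $g$ is $\#(\mathbb{N}_0\setminus\Lambda)$ and its conductor $c$ is the smallest integer with $c+\mathbb{N}_0\subseteq\Lambda$. $\Lambda$ is pseudo-symmetric if $c=2g-1$. $\Lambda$ is generated by the interval $\{i,i+1,\dots,j\}$ (integers $1\le i\leq j$) if $\Lambda=\{n_i i+n_{i+1}(i+1)+\dots+n_j j: n_i,\dots,n_j\in\mathbb{N}_0\}$. -}

module Defs where

open import Data.Nat using (ℕ; zero; suc; _+_; _*_; _∸_; _≤_)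
open import Data.Fin using (Fin; toℕ) renaming (zero to fzero; suc to fsuc)
open import Data.Product using (Σ; ∃; _×_)
open import Data.Sum using (_⊎_)
open import Data.List using (List; length)
open import Data.List.Membership.Propositional using (_∈_)
open import Data.List.Relation.Unary.Unique.Propositional using (Unique)
open import Relation.Binary.PropositionalEquality using (_≡_)
open import Relation.Nullary using (¬_)
open import Function.Bundles using (_⇔_)

Subsetℕ : Set₁
Subsetℕ = ℕ → Set

∑ : (n : ℕ) → (Fin n → ℕ) → ℕ
∑ zero    f = 0
∑ (suc n) f = f fzero + ∑ n (λ k → f (fsuc k))

IsNumericalSemigroup : Subsetℕ → Set
IsNumericalSemigroup Λ =
  Λ 0 × (∀ m n → Λ m → Λ n → Λ (m + n)) × (∃ λ N → ∀ n → N ≤ n → Λ n)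

IsGenus : Subsetℕ → ℕ → Set
IsGenus Λ g = Σ (List ℕ) λ xs →
  Unique xs × (∀ n → (n ∈ xs) ⇔ (¬ Λ n)) × (length xs ≡ g)

IsConductor : Subsetℕ → ℕ → Set
IsConductor Λ c = (∀ n → Λ (c + n)) × (∀ c' → (∀ n → Λ (c' + n)) → c ≤ c')

-- Pseudo-symmetric: c = 2g - 1 (stated as c + 1 = 2g to avoid truncated subtraction).
IsPseudoSymmetric : Subsetℕ → Set
IsPseudoSymmetric Λ = ∃ λ g → ∃ λ c → IsGenus Λ g × IsConductor Λ c × (c + 1 ≡ 2 * g)

-- The set generated by the interval {i, i+1, …, j} (for i ≤ j):
-- all n_i i + … + n_j j with n_k ∈ ℕ₀; coefficient k ∈ Fin (j - i + 1) belongs to generator i + k.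
GeneratedByInterval : ℕ → ℕ → Subsetℕ
GeneratedByInterval i j n =
  Σ (Fin (suc (j ∸ i)) → ℕ) λ coeff → n ≡ ∑ (suc (j ∸ i)) (λ k → coeff k * (i + toℕ k))

IsGeneratedByAnInterval : Subsetℕ → Set
IsGeneratedByAnInterval Λ =
  ∃ λ i → ∃ λ j → 1 ≤ i × i ≤ j × (∀ n → Λ n ⇔ GeneratedByInterval i j n)

Λ₃ : Subsetℕ
Λ₃ n = (n ≡ 0) ⊎ (3 ≤ n)

-- Two general facts drive the proof.
--  * Interval generation: n is generated by {i, …, j} iff K·i ≤ n ≤ K·j for some K
--    (generated-bounds and between-multiples).
--  * Gap pairs: if F is a gap and the genus satisfies 2g ≤ F + 2, then no two distinct gaps
--    sum to F (no-gap-pair), by counting gaps among n and F − n for n ≤ F (sumBelow).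
-- For uniqueness (module Uniqueness) let F = c − 1; c is odd since c + 1 = 2g.  The first
-- fact gives i ≥ 2 (so 1 is a gap), c = (B + 1)·i, and that c − 2 is a gap (otherwise
-- c − 2 = B·j and c would be even).  The second fact, applied to the gaps 1 and c − 2 with
-- sum F, forces c − 2 = 1; so c = 3 and Λ = Λ₃ (Λ₃-characterisation).  Existence is a
-- direct check, with Λ₃ generated by {3, 4, 5}.
module Submission where

open import Defs
open import Data.Nat using (ℕ; zero; suc; _+_; _*_; _∸_; _≤_; _<_; z≤n; s≤s; s≤s⁻¹; _≤?_; _≟_)
open import Data.Nat.Properties
open import Data.Fin using (Fin; toℕ; fromℕ<) renaming (zero to fzero; suc to fsuc)
open import Data.Fin.Properties using (toℕ<n; toℕ-fromℕ<)
open import Data.Product using (∃; _×_; _,_; proj₁; proj₂)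
open import Data.Sum using (_⊎_; inj₁; inj₂)
open import Data.Nat.Divisibility using (_∣_; divides; ∣-refl; ∣-trans; ∣m∣n⇒∣m+n; m∣m*n)
open import Data.Empty using (⊥; ⊥-elim)
open import Relation.Nullary using (¬_; Dec; yes; no; contradiction)
open import Relation.Binary using (tri<; tri≈; tri>)
open import Data.List using (List; []; _∷_; length)
open import Data.List.Membership.Propositional using (_∈_)
open import Data.List.Membership.DecPropositional _≟_ using (_∈?_)
open import Data.List.Relation.Unary.Any using (here; there)
open import Data.List.Relation.Unary.Unique.Propositional using (Unique)
import Data.List.Relation.Unary.All as All
import Data.List.Relation.Unary.AllPairs as AllPairs
open import Relation.Binary.PropositionalEquality
open import Function.Bundles using (_⇔_; mk⇔; Equivalence)
open import Algebra.Properties.CommutativeSemigroup +-commutativeSemigroup using (interchange; x∙yz≈y∙xz)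

∑-zero : ∀ m → ∑ m (λ _ → 0) ≡ 0
∑-zero zero    = refl
∑-zero (suc m) = ∑-zero m

∑-+ : ∀ m (f g : Fin m → ℕ) → ∑ m (λ k → f k + g k) ≡ ∑ m f + ∑ m g
∑-+ zero    f g = refl
∑-+ (suc m) f g = begin
  f fzero + g fzero + ∑ m (λ k → f (fsuc k) + g (fsuc k))
    ≡⟨ cong (f fzero + g fzero +_) (∑-+ m (λ k → f (fsuc k)) (λ k → g (fsuc k))) ⟩
  f fzero + g fzero + (∑ m (λ k → f (fsuc k)) + ∑ m (λ k → g (fsuc k)))
    ≡⟨ interchange (f fzero) (g fzero) _ _ ⟩
  f fzero + ∑ m (λ k → f (fsuc k)) + (g fzero + ∑ m (λ k → g (fsuc k))) ∎
  where open ≡-Reasoning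

∑-*ʳ : ∀ m (f : Fin m → ℕ) a → ∑ m f * a ≡ ∑ m (λ k → f k * a)
∑-*ʳ zero    f a = refl
∑-*ʳ (suc m) f a = trans (*-distribʳ-+ a (f fzero) _) (cong (f fzero * a +_) (∑-*ʳ m (λ k → f (fsuc k)) a))

∑-mono : ∀ m {f g : Fin m → ℕ} → (∀ k → f k ≤ g k) → ∑ m f ≤ ∑ m g
∑-mono zero    f≤g = z≤n
∑-mono (suc m) f≤g = +-mono-≤ (f≤g fzero) (∑-mono m (λ k → f≤g (fsuc k)))

∑-cong : ∀ m {f g : Fin m → ℕ} → (∀ k → f k ≡ g k) → ∑ m f ≡ ∑ m g
∑-cong zero    f≡g = refl
∑-cong (suc m) f≡g = cong₂ _+_ (f≡g fzero) (∑-cong m (λ k → f≡g (fsuc k)))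

basis : ∀ {m} → Fin m → Fin m → ℕ
basis fzero    fzero    = 1
basis fzero    (fsuc k) = 0
basis (fsuc t) fzero    = 0
basis (fsuc t) (fsuc k) = basis t k

∑-basis : ∀ m (t : Fin m) (w : Fin m → ℕ) → ∑ m (λ k → basis t k * w k) ≡ w t
∑-basis (suc m) fzero    w = trans (cong (w fzero + 0 +_) (∑-zero m)) (trans (+-identityʳ _) (+-identityʳ _))
∑-basis (suc m) (fsuc t) w = ∑-basis m t (λ k → w (fsuc k))

module Interval (i j : ℕ) where

  weight : Fin (suc (j ∸ i)) → ℕ
  weight k = i + toℕ k

  weight-≤ : i ≤ j → ∀ k → weight k ≤ j
  weight-≤ i≤j k = subst (weight k ≤_) (m+[n∸m]≡n i≤j) (+-monoʳ-≤ i (s≤s⁻¹ (toℕ<n k)))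

  generated-zero : GeneratedByInterval i j 0
  generated-zero = (λ _ → 0) , sym (∑-zero (suc (j ∸ i)))

  generated-+ : ∀ {m n} → GeneratedByInterval i j m → GeneratedByInterval i j n
              → GeneratedByInterval i j (m + n)
  generated-+ {m} {n} (f , m≡) (g , n≡) = (λ k → f k + g k) , (begin
    m + n
      ≡⟨ cong₂ _+_ m≡ n≡ ⟩
    ∑ _ (λ k → f k * weight k) + ∑ _ (λ k → g k * weight k)
      ≡⟨ ∑-+ _ (λ k → f k * weight k) (λ k → g k * weight k) ⟨
    ∑ _ (λ k → f k * weight k + g k * weight k)
      ≡⟨ ∑-cong _ (λ k → *-distribʳ-+ (weight k) (f k) (g k)) ⟨
    ∑ _ (λ k → (f k + g k) * weight k)
      ∎)
    where open ≡-Reasoning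

  generator : ∀ {b} → i ≤ b → b ≤ j → GeneratedByInterval i j b
  generator {b} i≤b b≤j = basis t , (begin
    b                                  ≡⟨ m+[n∸m]≡n i≤b ⟨
    i + (b ∸ i)                        ≡⟨ cong (i +_) (toℕ-fromℕ< b∸i<) ⟨
    weight t                           ≡⟨ ∑-basis _ t weight ⟨
    ∑ _ (λ k → basis t k * weight k)   ∎)
    where
    open ≡-Reasoning
    b∸i< : b ∸ i < suc (j ∸ i)
    b∸i< = s≤s (∸-monoˡ-≤ i b≤j)
    t : Fin (suc (j ∸ i))
    t = fromℕ< b∸i<

  generated-bounds : i ≤ j → ∀ {n} → GeneratedByInterval i j n → ∃ λ K → K * i ≤ n × n ≤ K * j
  generated-bounds i≤j {n} (f , n≡) = ∑ _ f , lower , upper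
    where
    open ≤-Reasoning
    lower : ∑ _ f * i ≤ n
    lower = begin
      ∑ _ f * i                  ≡⟨ ∑-*ʳ _ f i ⟩
      ∑ _ (λ k → f k * i)        ≤⟨ ∑-mono _ (λ k → *-monoʳ-≤ (f k) (m≤m+n i (toℕ k))) ⟩
      ∑ _ (λ k → f k * weight k) ≡⟨ n≡ ⟨
      n                          ∎
    upper : n ≤ ∑ _ f * j
    upper = begin
      n                          ≡⟨ n≡ ⟩
      ∑ _ (λ k → f k * weight k) ≤⟨ ∑-mono _ (λ k → *-monoʳ-≤ (f k) (weight-≤ i≤j k)) ⟩
      ∑ _ (λ k → f k * j)        ≡⟨ ∑-*ʳ _ f j ⟨
      ∑ _ f * j                  ∎

  below-i-not-generated : i ≤ j → ∀ {n} → 0 < n → n < i → ¬ GeneratedByInterval i j n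
  below-i-not-generated i≤j 0<n n<i n-gen with generated-bounds i≤j n-gen
  ... | zero  , _      , n≤0 = <⇒≱ 0<n n≤0
  ... | suc K , i+Ki≤n , _   = <⇒≱ n<i (≤-trans (m≤m+n i (K * i)) i+Ki≤n)

-- A set containing 0 and every b ∈ [i, j], closed under addition, contains every n with
-- K·i ≤ n ≤ K·j: split off one summand from [i, j] and recurse on K.
between-multiples : (Λ : Subsetℕ) {i j : ℕ} → Λ 0 → (∀ m n → Λ m → Λ n → Λ (m + n))
                  → (∀ {b} → i ≤ b → b ≤ j → Λ b) → i ≤ j
                  → ∀ K {n} → K * i ≤ n → n ≤ K * j → Λ n
between-multiples Λ {i} {j} Λ0 closed interval i≤j = go
  where
  go : ∀ K {n} → K * i ≤ n → n ≤ K * j → Λ n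
  go zero    {n} _ n≤0 = subst Λ (sym (n≤0⇒n≡0 n≤0)) Λ0
  go (suc K) {n} lower upper with K * i + j ≤? n
  ... | yes Ki+j≤n = subst Λ (m∸n+n≡m j≤n) (closed (n ∸ j) j (go K rest-lower rest-upper) (interval i≤j ≤-refl))
    where
    j≤n : j ≤ n
    j≤n = m+n≤o⇒n≤o (K * i) Ki+j≤n
    rest-lower : K * i ≤ n ∸ j
    rest-lower = m+n≤o⇒m≤o∸n (K * i) Ki+j≤n
    rest-upper : n ∸ j ≤ K * j
    rest-upper = subst (n ∸ j ≤_) (m+n∸m≡n j (K * j)) (∸-monoˡ-≤ j upper)
  ... | no Ki+j≰n = subst Λ (m+[n∸m]≡n Ki≤n) (closed (K * i) (n ∸ K * i) (go K ≤-refl (*-monoʳ-≤ K i≤j)) (interval i≤rest rest≤j))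
    where
    Ki≤n : K * i ≤ n
    Ki≤n = m+n≤o⇒n≤o i lower
    i≤rest : i ≤ n ∸ K * i
    i≤rest = subst (_≤ n ∸ K * i) (m+n∸n≡m i (K * i)) (∸-monoˡ-≤ (K * i) lower)
    rest≤j : n ∸ K * i ≤ j
    rest≤j = subst (n ∸ K * i ≤_) (m+n∸m≡n (K * i) j) (∸-monoˡ-≤ (K * i) (<⇒≤ (≰⇒> Ki+j≰n)))

sumBelow : (ℕ → ℕ) → ℕ → ℕ
sumBelow f zero    = 0
sumBelow f (suc N) = f N + sumBelow f N

sumBelow-zero : ∀ {f} N → (∀ n → n < N → f n ≡ 0) → sumBelow f N ≡ 0
sumBelow-zero zero    f≡0 = refl
sumBelow-zero (suc N) f≡0 = cong₂ _+_ (f≡0 N ≤-refl) (sumBelow-zero N (λ n n<N → f≡0 n (m<n⇒m<1+n n<N)))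

sumBelow-+ : ∀ f g N → sumBelow (λ n → f n + g n) N ≡ sumBelow f N + sumBelow g N
sumBelow-+ f g zero    = refl
sumBelow-+ f g (suc N) = trans (cong (f N + g N +_) (sumBelow-+ f g N)) (interchange (f N) (g N) _ _)

sumBelow-mono : ∀ {f g} N → (∀ n → n < N → f n ≤ g n) → sumBelow f N ≤ sumBelow g N
sumBelow-mono zero    f≤g = z≤n
sumBelow-mono (suc N) f≤g = +-mono-≤ (f≤g N ≤-refl) (sumBelow-mono N (λ n n<N → f≤g n (m<n⇒m<1+n n<N)))

sumBelow-shift : ∀ f N → sumBelow f (suc N) ≡ f 0 + sumBelow (λ n → f (suc n)) N
sumBelow-shift f zero    = refl
sumBelow-shift f (suc N) = begin
  f (suc N) + sumBelow f (suc N)                        ≡⟨ cong (f (suc N) +_) (sumBelow-shift f N) ⟩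
  f (suc N) + (f 0 + sumBelow (λ n → f (suc n)) N)       ≡⟨ x∙yz≈y∙xz (f (suc N)) (f 0) _ ⟩
  f 0 + (f (suc N) + sumBelow (λ n → f (suc n)) N)       ∎
  where open ≡-Reasoning

sumBelow-reverse : ∀ f N → sumBelow (λ n → f (N ∸ suc n)) N ≡ sumBelow f N
sumBelow-reverse f zero    = refl
sumBelow-reverse f (suc N) = trans (sumBelow-shift (λ n → f (N ∸ n)) N) (cong (f N +_) (sumBelow-reverse f N))

term-≤-sumBelow : ∀ f {y} N → y < N → f y ≤ sumBelow f N
term-≤-sumBelow f (suc N) y<1+N with m≤n⇒m<n∨m≡n (s≤s⁻¹ y<1+N)
... | inj₁ y<N  = ≤-trans (term-≤-sumBelow f N y<N) (m≤n+m _ (f N))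
... | inj₂ refl = m≤m+n (f N) _

two-terms-≤-sumBelow : ∀ f {y₁ y₂} N → y₁ < y₂ → y₂ < N → f y₁ + f y₂ ≤ sumBelow f N
two-terms-≤-sumBelow f (suc N) y₁<y₂ y₂<1+N with m≤n⇒m<n∨m≡n (s≤s⁻¹ y₂<1+N)
... | inj₁ y₂<N = ≤-trans (two-terms-≤-sumBelow f N y₁<y₂ y₂<N) (m≤n+m _ (f N))
... | inj₂ refl = subst (_≤ f N + sumBelow f N) (+-comm (f N) _) (+-monoʳ-≤ (f N) (term-≤-sumBelow f N y₁<y₂))

sumBelow-positive : ∀ f N → (∀ n → n < N → 1 ≤ f n) → sumBelow f N ≡ N + sumBelow (λ n → f n ∸ 1) N
sumBelow-positive f zero    _    = refl
sumBelow-positive f (suc N) 1≤f = begin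
  f N + sumBelow f N                                  ≡⟨ cong₂ _+_ (m+[n∸m]≡n (1≤f N ≤-refl)) (sym (sumBelow-positive f N 1≤f′)) ⟨
  1 + (f N ∸ 1) + (N + sumBelow (λ n → f n ∸ 1) N)    ≡⟨ interchange 1 (f N ∸ 1) N _ ⟩
  suc N + sumBelow (λ n → f n ∸ 1) (suc N)            ∎
  where
  open ≡-Reasoning
  1≤f′ : ∀ n → n < N → 1 ≤ f n
  1≤f′ n n<N = 1≤f n (m<n⇒m<1+n n<N)

sumBelow-two-doubles : ∀ f N {y₁ y₂} → (∀ n → n < N → 1 ≤ f n) → y₁ < y₂ → y₂ < N
                     → 2 ≤ f y₁ → 2 ≤ f y₂ → N + 2 ≤ sumBelow f N
sumBelow-two-doubles f N {y₁} {y₂} 1≤f y₁<y₂ y₂<N 2≤fy₁ 2≤fy₂ = begin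
  N + 2                                     ≤⟨ +-monoʳ-≤ N (+-mono-≤ (∸-monoˡ-≤ 1 2≤fy₁) (∸-monoˡ-≤ 1 2≤fy₂)) ⟩
  N + ((f y₁ ∸ 1) + (f y₂ ∸ 1))             ≤⟨ +-monoʳ-≤ N (two-terms-≤-sumBelow (λ n → f n ∸ 1) N y₁<y₂ y₂<N) ⟩
  N + sumBelow (λ n → f n ∸ 1) N            ≡⟨ sumBelow-positive f N 1≤f ⟨
  sumBelow f N                              ∎
  where open ≤-Reasoning

⟦_⟧ : {P : Set} → Dec P → ℕ
⟦ yes _ ⟧ = 1
⟦ no _ ⟧  = 0

⟦⟧-yes : {P : Set} (d : Dec P) → P → ⟦ d ⟧ ≡ 1
⟦⟧-yes (yes _) _ = refl
⟦⟧-yes (no ¬p) p = contradiction p ¬p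

occurs : List ℕ → ℕ → ℕ
occurs xs n = ⟦ n ∈? xs ⟧

sumBelow-≟-≤1 : ∀ x N → sumBelow (λ n → ⟦ n ≟ x ⟧) N ≤ 1
sumBelow-≟-≤1 x zero    = z≤n
sumBelow-≟-≤1 x (suc N) with N ≟ x
... | no _     = sumBelow-≟-≤1 x N
... | yes refl = s≤s (≤-reflexive (sumBelow-zero N below-N-is-not-N))
  where
  below-N-is-not-N : ∀ n → n < N → ⟦ n ≟ N ⟧ ≡ 0
  below-N-is-not-N n n<N with n ≟ N
  ... | yes refl = contradiction n<N (<-irrefl refl)
  ... | no _     = refl

occurs-∷ : ∀ x xs n → occurs (x ∷ xs) n ≤ ⟦ n ≟ x ⟧ + occurs xs n
occurs-∷ x xs n = union-bound (n ∈? (x ∷ xs)) (n ≟ x) (n ∈? xs)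
  where
  union-bound : (d : Dec (n ∈ x ∷ xs)) (d₁ : Dec (n ≡ x)) (d₂ : Dec (n ∈ xs)) → ⟦ d ⟧ ≤ ⟦ d₁ ⟧ + ⟦ d₂ ⟧
  union-bound (no _)             _          _          = z≤n
  union-bound (yes _)            (yes _)    _          = s≤s z≤n
  union-bound (yes _)            (no _)     (yes _)    = s≤s z≤n
  union-bound (yes (here n≡x))   (no n≢x)   (no _)     = contradiction n≡x n≢x
  union-bound (yes (there n∈xs)) (no _)     (no n∉xs)  = contradiction n∈xs n∉xs

occurs-≤-length : ∀ xs N → sumBelow (occurs xs) N ≤ length xs
occurs-≤-length []       N = ≤-reflexive (sumBelow-zero N (λ n _ → refl))
occurs-≤-length (x ∷ xs) N = begin
  sumBelow (occurs (x ∷ xs)) N                                ≤⟨ sumBelow-mono N (λ n _ → occurs-∷ x xs n) ⟩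
  sumBelow (λ n → ⟦ n ≟ x ⟧ + occurs xs n) N                  ≡⟨ sumBelow-+ (λ n → ⟦ n ≟ x ⟧) (occurs xs) N ⟩
  sumBelow (λ n → ⟦ n ≟ x ⟧) N + sumBelow (occurs xs) N       ≤⟨ +-mono-≤ (sumBelow-≟-≤1 x N) (occurs-≤-length xs N) ⟩
  suc (length xs)                                             ∎
  where open ≤-Reasoning

-- Counting each n ≤ F once as itself and once as its mirror image F − n counts every
-- element of xs at most twice.
occurs-mirrored-≤ : ∀ xs F → sumBelow (λ n → occurs xs n + occurs xs (F ∸ n)) (suc F) ≤ 2 * length xs
occurs-mirrored-≤ xs F = begin
  sumBelow (λ n → occurs xs n + occurs xs (F ∸ n)) (suc F)
    ≡⟨ sumBelow-+ (occurs xs) (λ n → occurs xs (F ∸ n)) (suc F) ⟩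
  sumBelow (occurs xs) (suc F) + sumBelow (λ n → occurs xs (F ∸ n)) (suc F)
    ≡⟨ cong (sumBelow (occurs xs) (suc F) +_) (sumBelow-reverse (occurs xs) (suc F)) ⟩
  sumBelow (occurs xs) (suc F) + sumBelow (occurs xs) (suc F)
    ≤⟨ +-mono-≤ (occurs-≤-length xs (suc F)) (occurs-≤-length xs (suc F)) ⟩
  length xs + length xs
    ≡⟨ cong (length xs +_) (+-identityʳ (length xs)) ⟨
  2 * length xs
    ∎
  where open ≤-Reasoning

-- Let Λ be closed under addition with a gap F, and let xs list the gaps of Λ with
-- 2·|xs| ≤ F + 2.  For every n ≤ F one of n, F − n is a gap (else F ∈ Λ), so the sum
-- over n ≤ F of [n gap] + [F − n gap] is at least F + 1, plus one for every n with both
-- n and F − n gaps.  That sum is 2·#{gaps ≤ F} ≤ 2·|xs| ≤ F + 2, so there is no pair of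
-- gaps y₁ < y₂ with y₁ + y₂ = F.
no-gap-pair : (Λ : Subsetℕ) → (∀ m n → Λ m → Λ n → Λ (m + n)) → ∀ {F} → ¬ Λ F
            → (xs : List ℕ) → (∀ n → (n ∈ xs) ⇔ (¬ Λ n)) → 2 * length xs ≤ F + 2
            → ∀ {y₁ y₂} → y₁ < y₂ → y₁ + y₂ ≡ F → ¬ Λ y₁ → ¬ Λ y₂ → ⊥
no-gap-pair Λ closed {F} F-gap xs gaps genus {y₁} {y₂} y₁<y₂ y₁+y₂≡F y₁-gap y₂-gap =
  <-irrefl refl (begin-strict
    F + 2
      <⟨ +-monoˡ-< 2 (n<1+n F) ⟩
    suc F + 2
      ≤⟨ sumBelow-two-doubles pair-count (suc F) at-least-one y₁<y₂ y₂<1+F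
           (two-gaps y₁+y₂≡F y₁-gap y₂-gap) (two-gaps (trans (+-comm y₂ y₁) y₁+y₂≡F) y₂-gap y₁-gap) ⟩
    sumBelow pair-count (suc F)
      ≤⟨ occurs-mirrored-≤ xs F ⟩
    2 * length xs
      ≤⟨ genus ⟩
    F + 2
      ∎)
  where
  open ≤-Reasoning
  pair-count : ℕ → ℕ
  pair-count n = occurs xs n + occurs xs (F ∸ n)

  y₂<1+F : y₂ < suc F
  y₂<1+F = s≤s (subst (y₂ ≤_) y₁+y₂≡F (m≤n+m y₂ y₁))

  at-least-one : ∀ n → n < suc F → 1 ≤ pair-count n
  at-least-one n n<1+F = cases (n ∈? xs) ((F ∸ n) ∈? xs)
    where
    in-Λ : ∀ {m} → ¬ m ∈ xs → ¬ ¬ Λ m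
    in-Λ m∉xs m-gap = m∉xs (Equivalence.from (gaps _) m-gap)
    cases : (d₁ : Dec (n ∈ xs)) (d₂ : Dec ((F ∸ n) ∈ xs)) → 1 ≤ ⟦ d₁ ⟧ + ⟦ d₂ ⟧
    cases (yes _) _       = s≤s z≤n
    cases (no _)  (yes _) = s≤s z≤n
    cases (no n∉xs) (no F∸n∉xs) = contradiction (λ Λn → in-Λ F∸n∉xs (λ ΛF∸n →
      F-gap (subst Λ (m+[n∸m]≡n (s≤s⁻¹ n<1+F)) (closed n (F ∸ n) Λn ΛF∸n)))) (in-Λ n∉xs)

  two-gaps : ∀ {y z} → y + z ≡ F → ¬ Λ y → ¬ Λ z → 2 ≤ pair-count y
  two-gaps {y} {z} y+z≡F y-gap z-gap = ≤-reflexive (sym (cong₂ _+_ (gap-occurs y-gap)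
    (trans (cong (occurs xs) (trans (cong (_∸ y) (sym y+z≡F)) (m+n∸m≡n y z))) (gap-occurs z-gap))))
    where
    gap-occurs : ∀ {m} → ¬ Λ m → occurs xs m ≡ 1
    gap-occurs {m} m-gap = ⟦⟧-yes (m ∈? xs) (Equivalence.from (gaps m) m-gap)

odd-if-succ-even : ∀ {n g} → n + 1 ≡ 2 * g → ¬ 2 ∣ n
odd-if-succ-even {n} {g} n+1≡2g (divides q n≡q*2) = even≢odd g q (begin
  2 * g      ≡⟨ n+1≡2g ⟨
  n + 1      ≡⟨ +-comm n 1 ⟩
  suc n      ≡⟨ cong suc (trans n≡q*2 (*-comm q 2)) ⟩
  suc (2 * q) ∎)
  where open ≡-Reasoning

even-or-odd : ∀ n → 2 ∣ n ⊎ 2 ∣ suc n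
even-or-odd zero    = inj₁ (divides 0 refl)
even-or-odd (suc n) with even-or-odd n
... | inj₁ 2∣n   = inj₂ (∣m∣n⇒∣m+n (∣-refl {2}) 2∣n)
... | inj₂ 2∣1+n = inj₁ 2∣1+n

Λ₃-characterisation : (Λ : Subsetℕ) → Λ 0 → ¬ Λ 1 → ¬ Λ 2 → (∀ n → Λ (3 + n)) → ∀ n → Λ n ⇔ Λ₃ n
Λ₃-characterisation Λ Λ0 1∉Λ 2∉Λ from-3 n = mk⇔ (to n) from
  where
  to : ∀ n → Λ n → Λ₃ n
  to zero                _  = inj₁ refl
  to (suc zero)          Λ1 = contradiction Λ1 1∉Λ
  to (suc (suc zero))    Λ2 = contradiction Λ2 2∉Λ
  to (suc (suc (suc n))) _  = inj₂ (s≤s (s≤s (s≤s z≤n)))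
  from : Λ₃ n → Λ n
  from (inj₁ refl) = Λ0
  from (inj₂ 3≤n)  = subst Λ (m+[n∸m]≡n 3≤n) (from-3 (n ∸ 3))

module Uniqueness
  (Λ : Subsetℕ) (Λ0 : Λ 0) (closed : ∀ m n → Λ m → Λ n → Λ (m + n))
  {g c : ℕ} (xs : List ℕ) (gaps : ∀ n → (n ∈ xs) ⇔ (¬ Λ n)) (len : length xs ≡ g)
  (conductor : ∀ n → Λ (c + n)) (c-min : ∀ c' → (∀ n → Λ (c' + n)) → c ≤ c')
  (pseudo-symmetric : c + 1 ≡ 2 * g)
  {i j : ℕ} (1≤i : 1 ≤ i) (i≤j : i ≤ j) (gen : ∀ n → Λ n ⇔ GeneratedByInterval i j n)
  where
  open Interval i j

  multiple-bounds : ∀ {n} → Λ n → ∃ λ K → K * i ≤ n × n ≤ K * j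
  multiple-bounds {n} Λn = generated-bounds i≤j (Equivalence.to (gen n) Λn)

  from-bounds : ∀ K {n} → K * i ≤ n → n ≤ K * j → Λ n
  from-bounds = between-multiples Λ Λ0 closed (λ {b} i≤b b≤j → Equivalence.from (gen b) (generator i≤b b≤j)) i≤j

  below-i : ∀ {n} → 0 < n → n < i → ¬ Λ n
  below-i {n} 0<n n<i Λn = below-i-not-generated i≤j 0<n n<i (Equivalence.to (gen n) Λn)

  c-odd : ¬ 2 ∣ c
  c-odd = odd-if-succ-even {g = g} pseudo-symmetric

  F : ℕ
  F = c ∸ 1

  c≡1+F : c ≡ suc F
  c≡1+F = sym (m+[n∸m]≡n (n≢0⇒n>0 λ c≡0 → c-odd (subst (2 ∣_) (sym c≡0) (divides 0 refl))))

  F-gap : ¬ Λ F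
  F-gap ΛF = <⇒≱ (subst (F <_) (sym c≡1+F) ≤-refl) (c-min F F-conductor)
    where
    F-conductor : ∀ n → Λ (F + n)
    F-conductor zero    = subst Λ (sym (+-identityʳ F)) ΛF
    F-conductor (suc n) = subst Λ (trans (cong (_+ n) c≡1+F) (sym (+-suc F n))) (conductor n)

  -- i = 1 would put F = F·1 into Λ.
  2≤i : 2 ≤ i
  2≤i = ≤∧≢⇒< 1≤i λ 1≡i → F-gap (from-bounds F (≤-reflexive (trans (cong (F *_) (sym 1≡i)) (*-identityʳ F)))
                                                  (≤-trans (≤-reflexive (sym (*-identityʳ F))) (*-monoʳ-≤ F (≤-trans 1≤i i≤j))))

  1-gap : ¬ Λ 1
  1-gap = below-i (s≤s z≤n) 2≤i

  -- The conductor is a multiple of i: c = K·i with K·i ≤ c ≤ K·j, and K·i ≤ F would put F into Λ.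
  c-multiple : ∃ λ K → c ≡ K * i
  c-multiple with multiple-bounds (subst Λ (+-identityʳ c) (conductor 0))
  ... | K , Ki≤c , c≤Kj with K * i ≤? F
  ...   | yes Ki≤F = contradiction (from-bounds K Ki≤F (≤-trans (m∸n≤m c 1) c≤Kj)) F-gap
  ...   | no  Ki≰F = K , ≤-antisym (subst (_≤ K * i) (sym c≡1+F) (≰⇒> Ki≰F)) Ki≤c

  -- Writing c = (B + 1)·i (K = 0 would make c even).
  c-succ-multiple : ∃ λ B → c ≡ suc B * i
  c-succ-multiple with c-multiple
  ... | zero  , c≡0  = contradiction (subst (2 ∣_) (sym c≡0) (divides 0 refl)) c-odd
  ... | suc B , c≡Ki = B , c≡Ki

  B : ℕ
  B = proj₁ c-succ-multiple

  c≡[1+B]i : c ≡ suc B * i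
  c≡[1+B]i = proj₂ c-succ-multiple

  -- Writing c = 2 + m, which is possible since c ≥ i ≥ 2.
  m : ℕ
  m = c ∸ 2

  c≡2+m : c ≡ 2 + m
  c≡2+m = sym (m+[n∸m]≡n (≤-trans 2≤i (subst (i ≤_) (sym c≡[1+B]i) (m≤m+n i (B * i)))))

  F≡1+m : F ≡ suc m
  F≡1+m = cong (_∸ 1) c≡2+m

  -- m = F − 1 is a gap: otherwise m ≤ K′·j ≤ B·j with K′ ≤ B, while B·i ≤ F forces B·j < F
  -- (else F ∈ Λ); so m = B·j and c = B·j + 2 = (B + 1)·i would be even.
  m-gap : ¬ Λ m
  m-gap Λm with multiple-bounds Λm
  ... | K′ , K′i≤m , m≤K′j = c-odd (c-even (even-or-odd B))
    where
    K′≤B : K′ ≤ B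
    K′≤B = s≤s⁻¹ (*-cancelʳ-< i K′ (suc B) (<-≤-trans (s≤s K′i≤m) (≤-trans (n≤1+n (suc m)) (≤-reflexive (trans (sym c≡2+m) c≡[1+B]i)))))
    Bi≤F : B * i ≤ F
    Bi≤F = ≤-trans (+-cancelˡ-≤ 2 (B * i) m (≤-trans (+-monoˡ-≤ (B * i) 2≤i) (≤-reflexive (trans (sym c≡[1+B]i) c≡2+m))))
                   (subst (m ≤_) (sym F≡1+m) (n≤1+n m))
    Bj≤m : B * j ≤ m
    Bj≤m with F ≤? B * j
    ... | yes F≤Bj = contradiction (from-bounds B Bi≤F F≤Bj) F-gap
    ... | no  F≰Bj = s≤s⁻¹ (subst (B * j <_) F≡1+m (≰⇒> F≰Bj))
    c≡2+Bj : c ≡ 2 + B * j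
    c≡2+Bj = trans c≡2+m (cong (2 +_) (≤-antisym (≤-trans m≤K′j (*-monoˡ-≤ j K′≤B)) Bj≤m))
    c-even : 2 ∣ B ⊎ 2 ∣ suc B → 2 ∣ c
    c-even (inj₁ 2∣B)   = subst (2 ∣_) (sym c≡2+Bj) (∣m∣n⇒∣m+n (∣-refl {2}) (∣-trans 2∣B (m∣m*n j)))
    c-even (inj₂ 2∣1+B) = subst (2 ∣_) (sym c≡[1+B]i) (∣-trans 2∣1+B (m∣m*n i))

  genus : 2 * length xs ≤ F + 2
  genus = ≤-reflexive (begin
    2 * length xs  ≡⟨ cong (2 *_) len ⟩
    2 * g          ≡⟨ pseudo-symmetric ⟨
    c + 1          ≡⟨ cong (_+ 1) c≡1+F ⟩
    suc F + 1      ≡⟨ +-suc F 1 ⟨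
    F + 2          ∎)
    where open ≡-Reasoning

  -- 1 and m are gaps summing to F, which pseudo-symmetry allows only if they coincide.
  c≡3 : c ≡ 3
  c≡3 with <-cmp 1 m
  ... | tri< 1<m _ _ = ⊥-elim (no-gap-pair Λ closed F-gap xs gaps genus 1<m (sym F≡1+m) 1-gap m-gap)
  ... | tri≈ _ 1≡m _ = trans c≡2+m (cong (2 +_) (sym 1≡m))
  ... | tri> _ _ m<1 = contradiction (subst (2 ∣_) (sym (trans c≡2+m (cong (2 +_) (n<1⇒n≡0 m<1)))) (∣-refl {2})) c-odd

  Λ≡Λ₃ : ∀ n → Λ n ⇔ Λ₃ n
  Λ≡Λ₃ = Λ₃-characterisation Λ Λ0 1-gap (subst (λ k → ¬ Λ k) (cong (_∸ 1) c≡3) F-gap)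
                             (λ n → subst (λ k → Λ (k + n)) c≡3 (conductor n))

Λ₃-numerical : IsNumericalSemigroup Λ₃
Λ₃-numerical = inj₁ refl , closed , 3 , (λ _ → inj₂)
  where
  closed : ∀ m n → Λ₃ m → Λ₃ n → Λ₃ (m + n)
  closed m n (inj₁ refl) Λ₃n          = Λ₃n
  closed m n (inj₂ 3≤m)  (inj₁ refl)  = inj₂ (subst (3 ≤_) (sym (+-identityʳ m)) 3≤m)
  closed m n (inj₂ 3≤m)  (inj₂ _)     = inj₂ (≤-trans 3≤m (m≤m+n m n))

2∉Λ₃ : ¬ Λ₃ 2
2∉Λ₃ (inj₂ (s≤s (s≤s ())))

Λ₃-pseudo-symmetric : IsPseudoSymmetric Λ₃
Λ₃-pseudo-symmetric = 2 , 3 , (1 ∷ 2 ∷ [] , unique , (λ n → mk⇔ to (from n)) , refl) , (conductor , minimal) , refl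
  where
  unique : Unique (1 ∷ 2 ∷ [])
  unique = ((λ ()) All.∷ All.[]) AllPairs.∷ (All.[] AllPairs.∷ AllPairs.[])
  to : ∀ {n} → n ∈ (1 ∷ 2 ∷ []) → ¬ Λ₃ n
  to (here refl)         (inj₂ (s≤s ()))
  to (there (here refl)) = 2∉Λ₃
  from : ∀ n → ¬ Λ₃ n → n ∈ (1 ∷ 2 ∷ [])
  from zero                n-gap = contradiction (inj₁ refl) n-gap
  from (suc zero)          _     = here refl
  from (suc (suc zero))    _     = there (here refl)
  from (suc (suc (suc n))) n-gap = contradiction (inj₂ (s≤s (s≤s (s≤s z≤n)))) n-gap
  conductor : ∀ n → Λ₃ (3 + n)
  conductor n = inj₂ (m≤m+n 3 n)
  -- c′ ≤ 2 would put the gap 2 = c′ + (2 − c′) above c′.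
  minimal : ∀ c′ → (∀ n → Λ₃ (c′ + n)) → 3 ≤ c′
  minimal c′ above with 3 ≤? c′
  ... | yes 3≤c′ = 3≤c′
  ... | no  3≰c′ = contradiction (subst Λ₃ (m+[n∸m]≡n (s≤s⁻¹ (≰⇒> 3≰c′))) (above (2 ∸ c′))) 2∉Λ₃

generated-from-3 : ∀ n → GeneratedByInterval 3 5 (3 + n)
generated-from-3 zero                = Interval.generator 3 5 (s≤s (s≤s (s≤s z≤n))) (s≤s (s≤s (s≤s z≤n)))
generated-from-3 (suc zero)          = Interval.generator 3 5 (s≤s (s≤s (s≤s z≤n))) (s≤s (s≤s (s≤s (s≤s z≤n))))
generated-from-3 (suc (suc zero))    = Interval.generator 3 5 (s≤s (s≤s (s≤s z≤n))) ≤-refl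
generated-from-3 (suc (suc (suc n))) = Interval.generated-+ 3 5 (generated-from-3 zero) (generated-from-3 n)

Λ₃-interval : IsGeneratedByAnInterval Λ₃
Λ₃-interval = 3 , 5 , s≤s z≤n , 3≤5 , λ n → swap (Λ₃-characterisation (GeneratedByInterval 3 5)
  (Interval.generated-zero 3 5) (gap (s≤s z≤n) (s≤s (s≤s z≤n))) (gap (s≤s z≤n) (s≤s (s≤s (s≤s z≤n)))) generated-from-3 n)
  where
  3≤5 : 3 ≤ 5
  3≤5 = s≤s (s≤s (s≤s z≤n))
  gap : ∀ {n} → 0 < n → n < 3 → ¬ GeneratedByInterval 3 5 n
  gap = Interval.below-i-not-generated 3 5 3≤5
  swap : ∀ {A B : Set} → A ⇔ B → B ⇔ A
  swap A⇔B = mk⇔ (Equivalence.from A⇔B) (Equivalence.to A⇔B)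

mainTheorem7 :
    (IsNumericalSemigroup Λ₃ × IsPseudoSymmetric Λ₃ × IsGeneratedByAnInterval Λ₃)
    × (∀ (Λ : Subsetℕ) → IsNumericalSemigroup Λ → IsPseudoSymmetric Λ
        → IsGeneratedByAnInterval Λ → ∀ (n : ℕ) → Λ n ⇔ Λ₃ n)
mainTheorem7 = (Λ₃-numerical , Λ₃-pseudo-symmetric , Λ₃-interval) , unique
  where
  unique : ∀ (Λ : Subsetℕ) → IsNumericalSemigroup Λ → IsPseudoSymmetric Λ
         → IsGeneratedByAnInterval Λ → ∀ (n : ℕ) → Λ n ⇔ Λ₃ n
  unique Λ (Λ0 , closed , _) (_ , _ , (xs , _ , gaps , len) , (conductor , c-min) , c+1≡2g)
           (_ , _ , 1≤i , i≤j , gen) =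
    Uniqueness.Λ≡Λ₃ Λ Λ0 closed xs gaps len conductor c-min c+1≡2g 1≤i i≤j gen
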